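{- Let $h:\mathbb{N}\rightarrow\mathbb{N}\cup\{0\}$ be an unbounded non-decreasing function such that $h(n)\leq\log(n)$ for all $n\in\mathbb{N}$. Then for every $i\in\mathbb{N}$ there exist infinitely many $n\in\mathbb{N}$ such that $h(n)^i\geq h(n^i)$.
   Context: $\log$ denotes the logarithm to base 2. -}

module Defs where

open import Data.Nat using (ℕ; _≤_; _^_)
open import Data.Nat.Logarithm using (⌊log₂_⌋)
open import Data.Product using (∃-syntax; _×_)

-- The paper's ℕ = {1,2,3,...}; we model h : ℕ → ℕ and only constrain it on
-- positive arguments (the value h 0 is irrelevant).

NonDecreasing : (ℕ → ℕ) → Set
NonDecreasing h = ∀ m n → 1 ≤ m → m ≤ n → h m ≤ h n

Unbounded : (ℕ → ℕ) → Set
Unbounded h = ∀ B → ∃[ n ] (1 ≤ n × B ≤ h n)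

-- h(n) ≤ log₂ n for all n ∈ ℕ⁺ (for natural-valued h this is equivalent to
-- h(n) ≤ ⌊log₂ n⌋)
BoundedByLog : (ℕ → ℕ) → Set
BoundedByLog h = ∀ n → 1 ≤ n → h n ≤ ⌊log₂ n ⌋

InfinitelyMany : (ℕ → Set) → Set
InfinitelyMany P = ∀ N → ∃[ n ] (N ≤ n × 1 ≤ n × P n)

-- For i ≥ 2 and any a with h a ≥ 2, look at the orbit a, a^i, a^(i²), … of
-- n ↦ n^i. If h(n^i) ≤ h(n)^i failed at each of its first K points, then h would grow along
-- the orbit at least like (h a)^(i^k), so h(a^(i^K)) ≥ 2^(i^K). But h(a^E) ≤ log(a^E) < a·E,
-- which is smaller than 2^E once E = i^K ≥ a + 5. Unboundedness and monotonicity give such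
-- an a beyond any bound.
module Submission where

open import Defs
open import Data.Nat using (ℕ; _≤_; _^_; zero; suc; _+_; _*_; _<_; s≤s; z≤n; _≤?_; NonZero; >-nonZero)
open import Data.Nat.Properties
open import Data.Nat.Logarithm using (⌊log₂_⌋; ⌊log₂⌋-mono-≤; ⌊log₂[2^n]⌋≡n)
open import Data.Nat.Tactic.RingSolver using (solve-∀)
open import Data.Product using (_,_; ∃-syntax; _×_)
open import Data.Sum using (_⊎_; inj₁; inj₂)
open import Data.Empty using (⊥-elim)
open import Relation.Nullary using (yes; no)
open import Relation.Binary.PropositionalEquality using (_≡_; refl; sym; trans; cong)

n<2^n : ∀ n → n < 2 ^ n
n<2^n zero    = s≤s z≤n
n<2^n (suc n) = begin-strict
  suc n     ≤⟨ n<2^n n ⟩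
  2 ^ n     <⟨ m<m*n (2 ^ n) 2 {{m^n≢0 2 n}} (s≤s (s≤s z≤n)) ⟩
  2 ^ n * 2 ≡⟨ *-comm (2 ^ n) 2 ⟩
  2 ^ suc n ∎
  where open ≤-Reasoning

^≤2^* : ∀ n e → n ^ e ≤ 2 ^ (n * e)
^≤2^* n e = ≤-trans (^-monoˡ-≤ e (<⇒≤ (n<2^n n))) (≤-reflexive (^-*-assoc 2 n e))

⌊log₂[n^e]⌋≤n*e : ∀ n e → ⌊log₂ (n ^ e) ⌋ ≤ n * e
⌊log₂[n^e]⌋≤n*e n e = ≤-trans (⌊log₂⌋-mono-≤ (^≤2^* n e)) (≤-reflexive (⌊log₂[2^n]⌋≡n (n * e)))

[5+n]²<2^[5+n] : ∀ n → (5 + n) * (5 + n) < 2 ^ (5 + n)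
[5+n]²<2^[5+n] zero    = m≤m+n 26 6
[5+n]²<2^[5+n] (suc n) = begin
  suc (suc m * suc m)       ≡⟨ cong suc (square-suc m) ⟩
  suc (m * m) + suc (2 * m) ≤⟨ +-mono-≤ ih (≤-trans (s≤s 2m≤m²) ih) ⟩
  2 ^ m + 2 ^ m             ≡⟨ cong (2 ^ m +_) (sym (+-identityʳ (2 ^ m))) ⟩
  2 ^ suc m                 ∎
  where
  open ≤-Reasoning
  m = 5 + n
  ih : m * m < 2 ^ m
  ih = [5+n]²<2^[5+n] n
  square-suc : ∀ k → suc k * suc k ≡ k * k + suc (2 * k)
  square-suc = solve-∀
  2m≤m² : 2 * m ≤ m * m
  2m≤m² = *-monoˡ-≤ m (m≤m+n 2 (3 + n))

n²<2^n : ∀ n → 5 ≤ n → n * n < 2 ^ n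
n²<2^n n 5≤n with m≤n⇒∃[o]m+o≡n 5≤n
... | k , refl = [5+n]²<2^[5+n] k

m≤m^n : ∀ m n .{{_ : NonZero m}} .{{_ : NonZero n}} → m ≤ m ^ n
m≤m^n m (suc n) = m≤m*n m (m ^ n) {{m^n≢0 m n}}

^-^-suc : ∀ a i k → (a ^ (i ^ k)) ^ i ≡ a ^ (i ^ suc k)
^-^-suc a i k = trans (^-*-assoc a (i ^ k) i) (cong (a ^_) (*-comm (i ^ k) i))

orbit-witness-or-growth : ∀ (h : ℕ → ℕ) i a k →
  (∃[ j ] h ((a ^ (i ^ j)) ^ i) ≤ h (a ^ (i ^ j)) ^ i) ⊎ h a ^ (i ^ k) ≤ h (a ^ (i ^ k))
orbit-witness-or-growth h i a zero =
  inj₂ (≤-reflexive (trans (^-identityʳ (h a)) (cong h (sym (^-identityʳ a)))))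
orbit-witness-or-growth h i a (suc k) with orbit-witness-or-growth h i a k
... | inj₁ witness = inj₁ witness
... | inj₂ growth with h ((a ^ (i ^ k)) ^ i) ≤? h (a ^ (i ^ k)) ^ i
...   | yes holds = inj₁ (k , holds)
...   | no fails  = inj₂ (begin
  h a ^ (i ^ suc k)       ≡⟨ sym (^-^-suc (h a) i k) ⟩
  (h a ^ (i ^ k)) ^ i     ≤⟨ ^-monoˡ-≤ i growth ⟩
  h (a ^ (i ^ k)) ^ i     ≤⟨ <⇒≤ (≰⇒> fails) ⟩
  h ((a ^ (i ^ k)) ^ i)   ≡⟨ cong h (^-^-suc a i k) ⟩
  h (a ^ (i ^ suc k))     ∎)
  where open ≤-Reasoning

BoundedByLog⇒h[a^E]<2^E : ∀ {h} → BoundedByLog h → ∀ a E .{{_ : NonZero a}} →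
  5 + a ≤ E → h (a ^ E) < 2 ^ E
BoundedByLog⇒h[a^E]<2^E {h} bounded a E 5+a≤E = begin-strict
  h (a ^ E)         ≤⟨ bounded (a ^ E) (m^n>0 a E) ⟩
  ⌊log₂ (a ^ E) ⌋   ≤⟨ ⌊log₂[n^e]⌋≤n*e a E ⟩
  a * E             ≤⟨ *-monoˡ-≤ E (≤-trans (m≤n+m a 5) 5+a≤E) ⟩
  E * E             <⟨ n²<2^n E (≤-trans (m≤m+n 5 a) 5+a≤E) ⟩
  2 ^ E             ∎
  where open ≤-Reasoning

witness-above : ∀ {h} → BoundedByLog h → ∀ i → 2 ≤ i → ∀ a → 1 ≤ a → 2 ≤ h a →
  ∃[ n ] (a ≤ n × h (n ^ i) ≤ h n ^ i)
witness-above {h} bounded i 2≤i a 1≤a 2≤ha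
  with orbit-witness-or-growth h i a (5 + a)
... | inj₁ (j , holds) =
  a ^ (i ^ j) , m≤m^n a (i ^ j) {{>-nonZero 1≤a}} {{m^n≢0 i j {{>-nonZero (≤-trans (s≤s z≤n) 2≤i)}}}} , holds
... | inj₂ growth = ⊥-elim (<⇒≱ (BoundedByLog⇒h[a^E]<2^E bounded a E {{>-nonZero 1≤a}} 5+a≤E)
                                (≤-trans (^-monoˡ-≤ E 2≤ha) growth))
  where
  E = i ^ (5 + a)
  5+a≤E : 5 + a ≤ E
  5+a≤E = ≤-trans (<⇒≤ (n<2^n (5 + a))) (^-monoˡ-≤ (5 + a) 2≤i)

eventually-≥ : ∀ {h} → Unbounded h → NonDecreasing h → ∀ B N → ∃[ a ] (N ≤ a × 1 ≤ a × B ≤ h a)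
eventually-≥ unbounded nondecreasing B N with unbounded B
... | b , 1≤b , B≤hb =
  b + N , m≤n+m N b , ≤-trans 1≤b (m≤m+n b N) , ≤-trans B≤hb (nondecreasing b (b + N) 1≤b (m≤m+n b N))

lemma1 : (h : ℕ → ℕ) → Unbounded h → NonDecreasing h → BoundedByLog h →
    ∀ i → 1 ≤ i → InfinitelyMany (λ n → h (n ^ i) ≤ h n ^ i)
lemma1 h unbounded nondecreasing bounded 1 _ N =
  suc N , n≤1+n N , s≤s z≤n , ≤-reflexive (trans (cong h (^-identityʳ (suc N))) (sym (^-identityʳ (h (suc N)))))
lemma1 h unbounded nondecreasing bounded i@(suc (suc _)) _ N
  with eventually-≥ unbounded nondecreasing 2 N
... | a , N≤a , 1≤a , 2≤ha with witness-above bounded i (s≤s (s≤s z≤n)) a 1≤a 2≤ha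
... | n , a≤n , holds = n , ≤-trans N≤a a≤n , ≤-trans 1≤a a≤n , holds
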